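{- Let $q$ be a power of an odd prime $p$ with $q\equiv 1\pmod 3$, let $R$ be the graph defined below over $\mathbb F_q$, and let $\phi$ be an automorphism of $R$ with associated functions $\lambda_2,\pi_2$. Then $\lambda_2(a)=\pi_2(a)=a$ for every $a$ in the prime subfield $\mathbb F_p\subseteq\mathbb F_q$.
   Context: $R$ is the bipartite graph whose parts are the set of points $(p_1,p_2,p_3)\in\mathbb F_q^3$ and the set of lines $[l_1,l_2,l_3]\in\mathbb F_q^3$ (two disjoint copies of $\mathbb F_q^3$), where $(p_1,p_2,p_3)$ is adjacent to $[l_1,l_2,l_3]$ if and only if $p_2+l_2 = p_1l_1$ and $p_3+l_3 = p_1p_2l_1(p_1+p_2+p_1p_2)$. For such $q$, every automorphism $\phi$ of $R$ maps points to points and lines to lines, and there are functions $\lambda_1,\pi_1:\mathbb F_q^3\to\mathbb F_q$ and $\lambda_2,\lambda_3,\pi_2,\pi_3:\mathbb F_q\to\mathbb F_q$ (depending on $\phi$) with $\phi([x,y,z])=[\lambda_1(x,y,z),\lambda_2(y),\lambda_3(z)]$ and $\phi((x,y,z))=(\pi_1(x,y,z),\pi_2(y),\pi_3(z))$ for all $x,y,z\in\mathbb F_q$. -}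

module Defs where

open import Level using (0ℓ)
open import Data.Nat using (ℕ; zero; suc)
open import Data.Fin using (Fin)
open import Data.Product using (_×_; _,_; ∃)
open import Data.Sum using (_⊎_; inj₁; inj₂)
open import Data.Empty using (⊥)
open import Relation.Nullary using (¬_)
open import Relation.Binary.PropositionalEquality using (_≡_)
open import Algebra.Structures using (IsCommutativeRing)
open import Function.Bundles using (_↔_; Inverse)

record FiniteField (q : ℕ) : Set₁ where
  infixl 6 _+_
  infixl 7 _*_
  field
    F          : Set
    _+_ _*_    : F → F → F
    -_         : F → F
    0# 1#      : F
    isCommRing : IsCommutativeRing _≡_ _+_ _*_ -_ 0# 1#
    0≢1        : ¬ (0# ≡ 1#)
    inverse    : ∀ x → ¬ (x ≡ 0#) → ∃ λ y → x * y ≡ 1#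
    card       : F ↔ Fin q

  -- n · 1 ; the prime subfield F_p is exactly the image of this map.
  ι : ℕ → F
  ι zero    = 0#
  ι (suc n) = 1# + ι n

  Point : Set
  Point = F × F × F

  Line : Set
  Line = F × F × F

  Vertex : Set
  Vertex = Point ⊎ Line

  Incident : Point → Line → Set
  Incident (p₁ , p₂ , p₃) (l₁ , l₂ , l₃) =
    (p₂ + l₂ ≡ p₁ * l₁) ×
    (p₃ + l₃ ≡ p₁ * p₂ * l₁ * (p₁ + p₂ + p₁ * p₂))

  Adj : Vertex → Vertex → Set
  Adj (inj₁ p) (inj₂ l) = Incident p l
  Adj (inj₂ l) (inj₁ p) = Incident p l
  Adj (inj₁ _) (inj₁ _) = ⊥
  Adj (inj₂ _) (inj₂ _) = ⊥

  record Automorphism : Set where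
    field
      φ       : Vertex ↔ Vertex
      adj-iff : ∀ u v → (Adj u v → Adj (Inverse.to φ u) (Inverse.to φ v))
                      × (Adj (Inverse.to φ u) (Inverse.to φ v) → Adj u v)

{-# OPTIONS --safe #-}
module Submission where

-- Points (0, y, z) lie on every line [a, −y, −z]; comparing the images for
-- a = 0 and a = 1 forces π₁(0, y, z) = 0, hence π₂(y) + λ₂(−y) = 0 and
-- π₃(z) + λ₃(−z) = 0. The second incidence equation can be written as
-- z + c = (y + b) · y · (x ∘ y) with x ∘ y = x + y + xy, and x ↦ x ∘ y is
-- injective unless y = −1. Comparing the images of (1, y, 0) and (e, y, 0)
-- for some e ∉ {0, 1} therefore gives π₂(0) = 0 and π₂(−1) = −1. The images of
-- the incidences (1, −1, −t) ~ [s, s + 1, s + t] then read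
-- λ₃(s + t) = λ₃(t) + μ(s) with μ(s) = λ₂(s + 1) − 1, so μ is additive with
-- μ(−1) = −1 and fixes the prime field, and so do λ₂ and π₂.

open import Defs
open import Data.Nat using (ℕ; zero; suc; _^_; _%_; _≥_; _≤_; s≤s; nonTrivial⇒n>1)
import Data.Nat as ℕ
import Data.Nat.Properties as ℕ
open import Data.Nat.Primality using (Prime; prime⇒nonTrivial; prime⇒nonZero)
open import Data.Integer as ℤ using (ℤ; -[1+_]; 0ℤ; 1ℤ; -1ℤ)
import Data.Integer.Properties as ℤ
open import Data.Fin using (Fin; zero; suc)
open import Data.Fin.Properties using (inj⇒≟)
open import Data.Maybe as Maybe using (Maybe)
open import Data.Product using (_×_; _,_; proj₁; proj₂; ∃)
open import Data.Sum using (inj₁; inj₂)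
open import Data.Sum.Properties using (inj₁-injective; inj₂-injective)
open import Function using (_∘_; Injection; Inverse; _↔_)
open import Function.Properties.Inverse using (↔⇒↣)
open import Level using (0ℓ)
open import Relation.Nullary using (¬_)
open import Relation.Nullary.Decidable using (decidable-stable; dec⇒maybe)
open import Relation.Binary.Definitions using (DecidableEquality)
open import Relation.Binary.PropositionalEquality
  using (_≡_; _≢_; refl; sym; trans; cong; cong₂; subst; subst₂; module ≡-Reasoning)
open import Algebra.Bundles using (CommutativeRing)
import Algebra.Properties.Ring as RingProperties
import Algebra.Properties.Semiring.Mult.TCOptimised as SemiringMultiplication
open import Algebra.Solver.Ring.AlmostCommutativeRing using (fromCommutativeRing; _-Raw-AlmostCommutative⟶_)

3≤oddPrime^k : ∀ {p k} → Prime p → p ≢ 2 → k ≥ 1 → 3 ≤ p ^ k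
3≤oddPrime^k {p} {k} pr p≢2 k≥1 = ℕ.≤-trans 3≤p p≤p^k
  where
  instance _ = prime⇒nonTrivial pr
  instance _ = prime⇒nonZero pr
  3≤p : 3 ≤ p
  3≤p = ℕ.≤∧≢⇒< (nonTrivial⇒n>1 p) (p≢2 ∘ sym)
  p≤p^k : p ≤ p ^ k
  p≤p^k = subst (_≤ p ^ k) (ℕ.*-identityʳ p) (ℕ.^-monoʳ-≤ p k≥1)

∃-avoiding-two : ∀ {A : Set} {n} → 3 ≤ n → A ↔ Fin n → (a b : A) → ∃ λ e → e ≢ a × e ≢ b
∃-avoiding-two 3≤n A↔Fin a b =
  let k , k≢a , k≢b = Fin-avoiding-two 3≤n (to a) (to b)
  in from k , k≢a ∘ from-moved , k≢b ∘ from-moved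
  where
  open Inverse A↔Fin
  from-moved : ∀ {k x} → from k ≡ x → k ≡ to x
  from-moved {k} eq = trans (sym (strictlyInverseˡ k)) (cong to eq)
  Fin-avoiding-two : ∀ {n} → 3 ≤ n → (i j : Fin n) → ∃ λ k → k ≢ i × k ≢ j
  Fin-avoiding-two (s≤s (s≤s (s≤s _))) zero           zero           = suc zero , (λ ()) , (λ ())
  Fin-avoiding-two (s≤s (s≤s (s≤s _))) zero           (suc zero)     = suc (suc zero) , (λ ()) , (λ ())
  Fin-avoiding-two (s≤s (s≤s (s≤s _))) zero           (suc (suc _))  = suc zero , (λ ()) , (λ ())
  Fin-avoiding-two (s≤s (s≤s (s≤s _))) (suc zero)     zero           = suc (suc zero) , (λ ()) , (λ ())
  Fin-avoiding-two (s≤s (s≤s (s≤s _))) (suc (suc _))  zero           = suc zero , (λ ()) , (λ ())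
  Fin-avoiding-two (s≤s (s≤s (s≤s _))) (suc _)        (suc _)        = zero , (λ ()) , (λ ())

-- Normalisation must compute on coefficients, which elements of an abstract
-- ring cannot do; ℤ can, and it maps into every commutative ring.
module IntegerCoefficientSolver {c ℓ} (R : CommutativeRing c ℓ) where

  private
    open CommutativeRing R
      using ( Carrier; _≈_; _+_; _*_; -_; 0#; 1#; ring; semiring; setoid; reflexive; +-cong; +-congˡ; +-congʳ
            ; -‿cong; +-assoc; +-comm; +-identityˡ; +-identityʳ; zeroˡ; zeroʳ; -‿inverseʳ)
      renaming (sym to ≈-sym; trans to ≈-trans; refl to ≈-refl)
    open RingProperties ring
      using (-0#≈0#; -‿involutive; -‿+-comm; -‿anti-homo-+; -‿distribˡ-*; -‿distribʳ-*; xyx⁻¹≈y)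
    open SemiringMultiplication semiring
      using (1+×; ×-homo-+; ×1-homo-*) renaming (_×_ to _×′_)
    open import Relation.Binary.Reasoning.Setoid setoid

    ⟦_⟧ : ℤ → Carrier
    ⟦ ℤ.+ n    ⟧ = n ×′ 1#
    ⟦ -[1+ n ] ⟧ = - (suc n ×′ 1#)

    -‿homo : ∀ i → ⟦ ℤ.- i ⟧ ≈ - ⟦ i ⟧
    -‿homo (ℤ.+ zero)  = ≈-sym -0#≈0#
    -‿homo (ℤ.+ suc n) = ≈-refl
    -‿homo -[1+ n ]    = ≈-sym (-‿involutive _)

    ⊖-homo : ∀ m n → ⟦ m ℤ.⊖ n ⟧ ≈ m ×′ 1# + - (n ×′ 1#)
    ⊖-homo zero    zero    = ≈-sym (-‿inverseʳ 0#)
    ⊖-homo zero    (suc n) = ≈-sym (+-identityˡ _)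
    ⊖-homo (suc m) zero    = ≈-sym (≈-trans (+-congˡ -0#≈0#) (+-identityʳ _))
    ⊖-homo (suc m) (suc n) = begin
      ⟦ suc m ℤ.⊖ suc n ⟧              ≈⟨ reflexive (cong ⟦_⟧ (ℤ.[1+m]⊖[1+n]≡m⊖n m n)) ⟩
      ⟦ m ℤ.⊖ n ⟧                      ≈⟨ ⊖-homo m n ⟩
      M + - N                          ≈⟨ xyx⁻¹≈y 1# (M + - N) ⟨
      1# + (M + - N) + - 1#            ≈⟨ +-congʳ (+-assoc 1# M (- N)) ⟨
      1# + M + - N + - 1#              ≈⟨ +-assoc (1# + M) (- N) (- 1#) ⟩
      1# + M + (- N + - 1#)            ≈⟨ +-congˡ (-‿anti-homo-+ 1# N) ⟨
      1# + M + - (1# + N)              ≈⟨ +-cong (1+× m 1#) (-‿cong (1+× n 1#)) ⟨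
      suc m ×′ 1# + - (suc n ×′ 1#)    ∎
      where
      M N : Carrier
      M = m ×′ 1#
      N = n ×′ 1#

    +-homo : ∀ i j → ⟦ i ℤ.+ j ⟧ ≈ ⟦ i ⟧ + ⟦ j ⟧
    +-homo (ℤ.+ m)  (ℤ.+ n)  = ×-homo-+ 1# m n
    +-homo (ℤ.+ m)  -[1+ n ] = ⊖-homo m (suc n)
    +-homo -[1+ m ] (ℤ.+ n)  = ≈-trans (⊖-homo n (suc m)) (+-comm _ _)
    +-homo -[1+ m ] -[1+ n ] = begin
      - (suc (suc (m ℕ.+ n)) ×′ 1#)      ≈⟨ reflexive (cong (λ k → - (suc k ×′ 1#)) (ℕ.+-suc m n)) ⟨
      - ((suc m ℕ.+ suc n) ×′ 1#)        ≈⟨ -‿cong (×-homo-+ 1# (suc m) (suc n)) ⟩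
      - (suc m ×′ 1# + suc n ×′ 1#)      ≈⟨ -‿+-comm _ _ ⟨
      - (suc m ×′ 1#) + - (suc n ×′ 1#)  ∎

    *-homo : ∀ i j → ⟦ i ℤ.* j ⟧ ≈ ⟦ i ⟧ * ⟦ j ⟧
    *-homo (ℤ.+ zero)  j           = ≈-sym (zeroˡ _)
    *-homo (ℤ.+ suc m) (ℤ.+ zero)  = ≈-trans (reflexive (cong ⟦_⟧ (ℤ.*-zeroʳ (ℤ.+ suc m)))) (≈-sym (zeroʳ _))
    *-homo (ℤ.+ suc m) (ℤ.+ suc n) = ×1-homo-* (suc m) (suc n)
    *-homo (ℤ.+ suc m) -[1+ n ]    = ≈-trans (-‿cong (×1-homo-* (suc m) (suc n))) (-‿distribʳ-* _ _)
    *-homo -[1+ m ]    (ℤ.+ zero)  = ≈-trans (reflexive (cong ⟦_⟧ (ℤ.*-zeroʳ -[1+ m ]))) (≈-sym (zeroʳ _))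
    *-homo -[1+ m ]    (ℤ.+ suc n) = ≈-trans (-‿cong (×1-homo-* (suc m) (suc n))) (-‿distribˡ-* _ _)
    *-homo -[1+ m ]    -[1+ n ]    = begin
      (suc m ℕ.* suc n) ×′ 1#  ≈⟨ ×1-homo-* (suc m) (suc n) ⟩
      M * N                    ≈⟨ -‿involutive (M * N) ⟨
      - - (M * N)              ≈⟨ -‿cong (-‿distribʳ-* M N) ⟩
      - (M * - N)              ≈⟨ -‿distribˡ-* M (- N) ⟩
      - M * - N                ∎
      where
      M N : Carrier
      M = suc m ×′ 1#
      N = suc n ×′ 1#

    homomorphism : ℤ.+-*-rawRing -Raw-AlmostCommutative⟶ fromCommutativeRing R
    homomorphism = record
      { ⟦_⟧ = ⟦_⟧ ; +-homo = +-homo ; *-homo = *-homo ; -‿homo = -‿homo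
      ; 0-homo = ≈-refl ; 1-homo = ≈-refl
      }

    equal? : ∀ i j → Maybe (⟦ i ⟧ ≈ ⟦ j ⟧)
    equal? i j = Maybe.map (reflexive ∘ cong ⟦_⟧) (dec⇒maybe (i ℤ.≟ j))

  open import Algebra.Solver.Ring ℤ.+-*-rawRing (fromCommutativeRing R) homomorphism equal? public

module FiniteFieldProperties {q : ℕ} (𝔽 : FiniteField q) where
  open FiniteField 𝔽
  open ≡-Reasoning

  commutativeRing : CommutativeRing 0ℓ 0ℓ
  commutativeRing = record { isCommutativeRing = isCommRing }

  open CommutativeRing commutativeRing using (ring)
  open CommutativeRing commutativeRing public
    using (+-assoc; +-comm; +-identityˡ; +-identityʳ; *-identityˡ; zeroˡ; zeroʳ; -‿inverseˡ; -‿inverseʳ)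
  open RingProperties ring public
    using ( -0#≈0#; -‿involutive; -‿injective; -‿distribʳ-*; +-cancelˡ; +-cancelʳ
          ; +-inverseʳ-unique; x∙y⁻¹≈ε⇒x≈y; x+x≈x⇒x≈0)
  open IntegerCoefficientSolver commutativeRing public

  _≟_ : DecidableEquality F
  _≟_ = inj⇒≟ (↔⇒↣ card)

  *-cancelˡ-≢0 : ∀ {a b c} → a ≢ 0# → a * b ≡ a * c → b ≡ c
  *-cancelˡ-≢0 {a} {b} {c} a≢0 ab≡ac = trans (sym (undo b)) (trans (cong (a⁻¹ *_) ab≡ac) (undo c))
    where
    a⁻¹ : F
    a⁻¹ = proj₁ (inverse a a≢0)
    undo : ∀ t → a⁻¹ * (a * t) ≡ t
    undo t = begin
      a⁻¹ * (a * t)  ≡⟨ solve 3 (λ a⁻¹ a t → a⁻¹ :* (a :* t) := (a :* a⁻¹) :* t) refl a⁻¹ a t ⟩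
      a * a⁻¹ * t    ≡⟨ cong (_* t) (proj₂ (inverse a a≢0)) ⟩
      1# * t         ≡⟨ *-identityˡ t ⟩
      t              ∎

  x*y≡0⇒y≡0 : ∀ {x y} → x ≢ 0# → x * y ≡ 0# → y ≡ 0#
  x*y≡0⇒y≡0 {x} x≢0 xy≡0 = *-cancelˡ-≢0 x≢0 (trans xy≡0 (sym (zeroʳ x)))

  -- The circle operation (1 + x)(1 + y) − 1 of ring theory; it is the last
  -- factor of the second incidence equation of R.
  circ : F → F → F
  circ x y = x + y + x * y

  circ≡affine : ∀ x y → circ x y ≡ (1# + y) * x + y
  circ≡affine = solve 2 (λ x y → x :+ y :+ x :* y := (con 1ℤ :+ y) :* x :+ y) refl

  circ-zeroʳ : ∀ {y} x → 1# + y ≡ 0# → circ x y ≡ y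
  circ-zeroʳ {y} x 1+y≡0 = begin
    circ x y           ≡⟨ circ≡affine x y ⟩
    (1# + y) * x + y   ≡⟨ cong (λ t → t * x + y) 1+y≡0 ⟩
    0# * x + y         ≡⟨ cong (_+ y) (zeroˡ x) ⟩
    0# + y             ≡⟨ +-identityˡ y ⟩
    y                  ∎

  circ-cancelʳ : ∀ {x x' y} → 1# + y ≢ 0# → circ x y ≡ circ x' y → x ≡ x'
  circ-cancelʳ {x} {x'} {y} 1+y≢0 eq = *-cancelˡ-≢0 1+y≢0 (+-cancelʳ y _ _ (begin
    (1# + y) * x + y    ≡⟨ circ≡affine x y ⟨
    circ x y            ≡⟨ eq ⟩
    circ x' y           ≡⟨ circ≡affine x' y ⟩
    (1# + y) * x' + y   ∎))

module _ {q : ℕ} (𝔽 : FiniteField q) where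
  open FiniteField 𝔽
  open FiniteFieldProperties 𝔽
  open ≡-Reasoning

  incident⇒third-coordinate : ∀ {x y z a b c} → Incident (x , y , z) (a , b , c) →
                              z + c ≡ (y + b) * (y * circ x y)
  incident⇒third-coordinate {x} {y} {z} {a} {b} {c} (first , second) = begin
    z + c                     ≡⟨ second ⟩
    x * y * a * circ x y      ≡⟨ solve 4 (λ x y a k → x :* y :* a :* k := x :* a :* (y :* k))
                                         refl x y a (circ x y) ⟩
    x * a * (y * circ x y)    ≡⟨ cong (_* (y * circ x y)) first ⟨
    (y + b) * (y * circ x y)  ∎

  module CoordinateAutomorphism
    (A : Automorphism)
    (λ₁ : F → F → F → F) (λ₂ λ₃ : F → F) (π₁ : F → F → F → F) (π₂ π₃ : F → F)
    (on-lines : ∀ x y z → Inverse.to (Automorphism.φ A) (inj₂ (x , y , z))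
                            ≡ inj₂ (λ₁ x y z , λ₂ y , λ₃ z))
    (on-points : ∀ x y z → Inverse.to (Automorphism.φ A) (inj₁ (x , y , z))
                             ≡ inj₁ (π₁ x y z , π₂ y , π₃ z))
    where

    open Automorphism A

    φ-injective : ∀ {u v} → Inverse.to φ u ≡ Inverse.to φ v → u ≡ v
    φ-injective = Injection.injective (↔⇒↣ φ)

    point-injective : ∀ {x y z x' y' z'} →
                      (π₁ x y z , π₂ y , π₃ z) ≡ (π₁ x' y' z' , π₂ y' , π₃ z') →
                      (x , y , z) ≡ (x' , y' , z')
    point-injective {x} {y} {z} {x'} {y'} {z'} eq = inj₁-injective (φ-injective
      (trans (on-points x y z) (trans (cong inj₁ eq) (sym (on-points x' y' z')))))

    line-injective : ∀ {x y z x' y' z'} →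
                     (λ₁ x y z , λ₂ y , λ₃ z) ≡ (λ₁ x' y' z' , λ₂ y' , λ₃ z') →
                     (x , y , z) ≡ (x' , y' , z')
    line-injective {x} {y} {z} {x'} {y'} {z'} eq = inj₂-injective (φ-injective
      (trans (on-lines x y z) (trans (cong inj₂ eq) (sym (on-lines x' y' z')))))

    image : ∀ {x y z a b c} → Incident (x , y , z) (a , b , c) →
            Incident (π₁ x y z , π₂ y , π₃ z) (λ₁ a b c , λ₂ b , λ₃ c)
    image {x} {y} {z} {a} {b} {c} =
      subst₂ Adj (on-points x y z) (on-lines a b c) ∘ proj₁ (adj-iff (inj₁ (x , y , z)) (inj₂ (a , b , c)))

    image-third-coordinate : ∀ {x y z a b c} → Incident (x , y , z) (a , b , c) →
                             π₃ z + λ₃ c ≡ (π₂ y + λ₂ b) * (π₂ y * circ (π₁ x y z) (π₂ y))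
    image-third-coordinate = incident⇒third-coordinate ∘ image

    origin-incident : ∀ y z a → Incident (0# , y , z) (a , - y , - z)
    origin-incident y z a =
        solve 2 (λ y a → y :+ :- y := con 0ℤ :* a) refl y a
      , solve 3 (λ y z a → z :+ :- z := con 0ℤ :* y :* a :* (con 0ℤ :+ y :+ con 0ℤ :* y)) refl y z a

    π₁-origin : ∀ y z → π₁ 0# y z ≡ 0#
    π₁-origin y z = decidable-stable (π₁ 0# y z ≟ 0#) λ u≢0 →
      0≢1 (cong proj₁ (line-injective (cong (_, λ₂ (- y) , λ₃ (- z))
        (*-cancelˡ-≢0 u≢0 (trans (sym (first-coordinate 0#)) (first-coordinate 1#))))))
      where
      first-coordinate : ∀ a → π₂ y + λ₂ (- y) ≡ π₁ 0# y z * λ₁ a (- y) (- z)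
      first-coordinate a = proj₁ (image (origin-incident y z a))

    π₂+λ₂∘-≡0 : ∀ y → π₂ y + λ₂ (- y) ≡ 0#
    π₂+λ₂∘-≡0 y = begin
      π₂ y + λ₂ (- y)                      ≡⟨ proj₁ (image (origin-incident y 0# 0#)) ⟩
      π₁ 0# y 0# * λ₁ 0# (- y) (- 0#)      ≡⟨ cong (_* λ₁ 0# (- y) (- 0#)) (π₁-origin y 0#) ⟩
      0# * λ₁ 0# (- y) (- 0#)              ≡⟨ zeroˡ _ ⟩
      0#                                   ∎

    π₃+λ₃∘-≡0 : ∀ z → π₃ z + λ₃ (- z) ≡ 0#
    π₃+λ₃∘-≡0 z = trans (image-third-coordinate (origin-incident 0# z 0#))
                        (trans (cong (_* (π₂ 0# * circ (π₁ 0# 0# z) (π₂ 0#))) (π₂+λ₂∘-≡0 0#)) (zeroˡ _))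

    π₃∘-+λ₃≡0 : ∀ t → π₃ (- t) + λ₃ t ≡ 0#
    π₃∘-+λ₃≡0 t = trans (cong (λ u → π₃ (- t) + λ₃ u) (sym (-‿involutive t))) (π₃+λ₃∘-≡0 (- t))

    λ₂≡-π₂∘- : ∀ b → λ₂ b ≡ - π₂ (- b)
    λ₂≡-π₂∘- b = trans (cong λ₂ (sym (-‿involutive b))) (+-inverseʳ-unique _ _ (π₂+λ₂∘-≡0 (- b)))

    π₁-injective : ∀ {x x' y z} → π₁ x y z ≡ π₁ x' y z → x ≡ x'
    π₁-injective {y = y} {z} eq = cong proj₁ (point-injective (cong (_, π₂ y , π₃ z) eq))

    π₂-injective : ∀ {y y'} → π₂ y ≡ π₂ y' → y ≡ y'
    π₂-injective {y} {y'} eq = cong (proj₁ ∘ proj₂) (point-injective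
      (cong₂ (λ u v → u , v , π₃ 0#) (trans (π₁-origin y 0#) (sym (π₁-origin y' 0#))) eq))

    λ₂-injective : ∀ {b b'} → λ₂ b ≡ λ₂ b' → b ≡ b'
    λ₂-injective {b} {b'} eq = -‿injective (π₂-injective (-‿injective
      (trans (sym (λ₂≡-π₂∘- b)) (trans eq (λ₂≡-π₂∘- b')))))

    π₂+λ₂≡0⇒≡- : ∀ {y b} → π₂ y + λ₂ b ≡ 0# → b ≡ - y
    π₂+λ₂≡0⇒≡- {y} eq = λ₂-injective (+-cancelˡ (π₂ y) _ _ (trans eq (sym (π₂+λ₂∘-≡0 y))))

    axis-incident : ∀ x → Incident (x , 0# , 0#) (1# , x , - 0#)
    axis-incident x =
        solve 1 (λ x → con 0ℤ :+ x := x :* con 1ℤ) refl x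
      , solve 1 (λ x → con 0ℤ :+ :- con 0ℤ := x :* con 0ℤ :* con 1ℤ :* (x :+ con 0ℤ :+ x :* con 0ℤ)) refl x

    unit-incident : ∀ {x w} → x * w ≡ 1# → Incident (x , - 1# , 0#) (- w , 0# , - 1#)
    unit-incident {x} {w} xw≡1 =
        (begin
          - 1# + 0#                 ≡⟨ +-identityʳ (- 1#) ⟩
          - 1#                      ≡⟨ cong -_ xw≡1 ⟨
          - (x * w)                 ≡⟨ -‿distribʳ-* x w ⟩
          x * - w                   ∎)
      , (begin
          0# + - 1#                 ≡⟨ +-identityˡ (- 1#) ⟩
          - 1#                      ≡⟨ cong -_ xw≡1 ⟨
          - (x * w)                 ≡⟨ solve 2 (λ x w → :- (x :* w)
                                           := x :* con -1ℤ :* :- w :* (x :+ con -1ℤ :+ x :* con -1ℤ)) refl x w ⟩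
          x * - 1# * - w * circ x (- 1#)  ∎)

    shift-incident : ∀ s t → Incident (1# , - 1# , - t) (s , s + 1# , s + t)
    shift-incident s t =
        solve 1 (λ s → con -1ℤ :+ (s :+ con 1ℤ) := con 1ℤ :* s) refl s
      , solve 2 (λ s t → :- t :+ (s :+ t)
                       := con 1ℤ :* con -1ℤ :* s :* (con 1ℤ :+ con -1ℤ :+ con 1ℤ :* con -1ℤ)) refl s t

    module _ (e : F) (e≢0 : e ≢ 0#) (e≢1 : e ≢ 1#) where

      circ-collision⇒1+π₂≡0 : ∀ y → circ (π₁ 1# y 0#) (π₂ y) ≡ circ (π₁ e y 0#) (π₂ y) →
                              1# + π₂ y ≡ 0#
      circ-collision⇒1+π₂≡0 y eq = decidable-stable ((1# + π₂ y) ≟ 0#) λ 1+Y≢0 →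
        e≢1 (sym (π₁-injective (circ-cancelʳ 1+Y≢0 eq)))

      circ-on-axis≡0 : π₂ 0# ≢ 0# → ∀ {x} → x ≢ 0# → circ (π₁ x 0# 0#) (π₂ 0#) ≡ 0#
      circ-on-axis≡0 Y≢0 {x} x≢0 = x*y≡0⇒y≡0 Y≢0 (x*y≡0⇒y≡0 first-factor≢0
        (trans (sym (image-third-coordinate (axis-incident x))) (π₃+λ₃∘-≡0 0#)))
        where
        first-factor≢0 : π₂ 0# + λ₂ x ≢ 0#
        first-factor≢0 eq = x≢0 (trans (π₂+λ₂≡0⇒≡- eq) -0#≈0#)

      π₂-zero : π₂ 0# ≡ 0#
      π₂-zero = decidable-stable (π₂ 0# ≟ 0#) λ Y≢0 → Y≢0 (begin
        π₂ 0#                         ≡⟨ circ-zeroʳ (π₁ 1# 0# 0#) (circ-collision⇒1+π₂≡0 0#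
                                           (trans (circ-on-axis≡0 Y≢0 1≢0) (sym (circ-on-axis≡0 Y≢0 e≢0)))) ⟨
        circ (π₁ 1# 0# 0#) (π₂ 0#)    ≡⟨ circ-on-axis≡0 Y≢0 1≢0 ⟩
        0#                            ∎)
        where
        1≢0 : 1# ≢ 0#
        1≢0 = 0≢1 ∘ sym

      λ₂-zero : λ₂ 0# ≡ 0#
      λ₂-zero = begin
        λ₂ 0#          ≡⟨ λ₂≡-π₂∘- 0# ⟩
        - π₂ (- 0#)    ≡⟨ cong (-_ ∘ π₂) -0#≈0# ⟩
        - π₂ 0#        ≡⟨ cong -_ π₂-zero ⟩
        - 0#           ≡⟨ -0#≈0# ⟩
        0#             ∎

      π₂-minus-one : π₂ (- 1#) ≡ - 1#
      π₂-minus-one = +-inverseʳ-unique 1# Y (circ-collision⇒1+π₂≡0 (- 1#)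
        (*-cancelˡ-≢0 Y≢0 (*-cancelˡ-≢0 Y≢0
          (trans (sym (third-on-unit (*-identityˡ 1#))) (third-on-unit (proj₂ (inverse e e≢0)))))))
        where
        Y : F
        Y = π₂ (- 1#)
        Y≢0 : Y ≢ 0#
        Y≢0 eq = 0≢1 (sym (-‿injective (trans (π₂-injective (trans eq (sym π₂-zero))) (sym -0#≈0#))))
        third-on-unit : ∀ {x w} → x * w ≡ 1# → π₃ 0# + λ₃ (- 1#) ≡ Y * (Y * circ (π₁ x (- 1#) 0#) Y)
        third-on-unit {x} xw≡1 = trans (image-third-coordinate (unit-incident xw≡1))
          (cong (_* (Y * circ (π₁ x (- 1#) 0#) Y)) (trans (cong (Y +_) λ₂-zero) (+-identityʳ Y)))

      μ : F → F
      μ s = - 1# + λ₂ (s + 1#)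

      λ₃-shift : ∀ s t → λ₃ (s + t) ≡ λ₃ t + μ s
      λ₃-shift s t = +-cancelˡ (π₃ (- t)) _ _ (begin
        π₃ (- t) + λ₃ (s + t)                   ≡⟨ image-third-coordinate (shift-incident s t) ⟩
        (Y + λ₂ (s + 1#)) * (Y * circ u Y)      ≡⟨ cong (λ v → (v + λ₂ (s + 1#)) * (v * circ u v)) π₂-minus-one ⟩
        μ s * (- 1# * circ u (- 1#))            ≡⟨ cong (λ v → μ s * (- 1# * v)) (circ-zeroʳ u (-‿inverseʳ 1#)) ⟩
        μ s * (- 1# * - 1#)                     ≡⟨ solve 1 (λ m → m :* (con -1ℤ :* con -1ℤ) := m) refl (μ s) ⟩
        μ s                                     ≡⟨ +-identityˡ (μ s) ⟨
        0# + μ s                                ≡⟨ cong (_+ μ s) (π₃∘-+λ₃≡0 t) ⟨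
        π₃ (- t) + λ₃ t + μ s                   ≡⟨ +-assoc (π₃ (- t)) (λ₃ t) (μ s) ⟩
        π₃ (- t) + (λ₃ t + μ s)                 ∎)
        where
        Y u : F
        Y = π₂ (- 1#)
        u = π₁ 1# (- 1#) (- t)

      μ-additive : ∀ s t → μ (s + t) ≡ μ s + μ t
      μ-additive s t = +-cancelˡ (λ₃ 0#) _ _ (begin
        λ₃ 0# + μ (s + t)      ≡⟨ λ₃-shift (s + t) 0# ⟨
        λ₃ (s + t + 0#)        ≡⟨ cong λ₃ (+-assoc s t 0#) ⟩
        λ₃ (s + (t + 0#))      ≡⟨ λ₃-shift s (t + 0#) ⟩
        λ₃ (t + 0#) + μ s      ≡⟨ cong (_+ μ s) (λ₃-shift t 0#) ⟩
        λ₃ 0# + μ t + μ s      ≡⟨ +-assoc (λ₃ 0#) (μ t) (μ s) ⟩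
        λ₃ 0# + (μ t + μ s)    ≡⟨ cong (λ₃ 0# +_) (+-comm (μ t) (μ s)) ⟩
        λ₃ 0# + (μ s + μ t)    ∎)

      μ-zero : μ 0# ≡ 0#
      μ-zero = x+x≈x⇒x≈0 (μ 0#) (trans (sym (μ-additive 0# 0#)) (cong μ (+-identityʳ 0#)))

      μ-neg : ∀ s → μ (- s) ≡ - μ s
      μ-neg s = +-inverseʳ-unique (μ s) (μ (- s))
        (trans (sym (μ-additive s (- s))) (trans (cong μ (-‿inverseʳ s)) μ-zero))

      μ-minus-one : μ (- 1#) ≡ - 1#
      μ-minus-one = begin
        - 1# + λ₂ (- 1# + 1#)   ≡⟨ cong (λ s → - 1# + λ₂ s) (-‿inverseˡ 1#) ⟩
        - 1# + λ₂ 0#            ≡⟨ cong (- 1# +_) λ₂-zero ⟩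
        - 1# + 0#               ≡⟨ +-identityʳ (- 1#) ⟩
        - 1#                    ∎

      μ-one : μ 1# ≡ 1#
      μ-one = -‿injective (trans (sym (μ-neg 1#)) μ-minus-one)

      μ-ι : ∀ n → μ (ι n) ≡ ι n
      μ-ι zero    = μ-zero
      μ-ι (suc n) = trans (μ-additive 1# (ι n)) (cong₂ _+_ μ-one (μ-ι n))

      λ₂-shift : ∀ s → λ₂ (s + 1#) ≡ 1# + μ s
      λ₂-shift s = solve 1 (λ l → l := con 1ℤ :+ (con -1ℤ :+ l)) refl (λ₂ (s + 1#))

      λ₂-ι : ∀ n → λ₂ (ι n) ≡ ι n
      λ₂-ι zero    = λ₂-zero
      λ₂-ι (suc n) = begin
        λ₂ (1# + ι n)     ≡⟨ cong λ₂ (+-comm 1# (ι n)) ⟩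
        λ₂ (ι n + 1#)     ≡⟨ λ₂-shift (ι n) ⟩
        1# + μ (ι n)      ≡⟨ cong (1# +_) (μ-ι n) ⟩
        1# + ι n          ∎

      λ₂-neg-ι : ∀ n → λ₂ (- ι n) ≡ - ι n
      λ₂-neg-ι n = begin
        λ₂ (- ι n)                ≡⟨ cong λ₂ (solve 1 (λ i → :- i := :- (con 1ℤ :+ i) :+ con 1ℤ) refl (ι n)) ⟩
        λ₂ (- (1# + ι n) + 1#)    ≡⟨ λ₂-shift (- ι (suc n)) ⟩
        1# + μ (- ι (suc n))      ≡⟨ cong (1# +_) (trans (μ-neg (ι (suc n))) (cong -_ (μ-ι (suc n)))) ⟩
        1# + - (1# + ι n)         ≡⟨ solve 1 (λ i → con 1ℤ :+ :- (con 1ℤ :+ i) := :- i) refl (ι n) ⟩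
        - ι n                     ∎

      π₂-ι : ∀ n → π₂ (ι n) ≡ ι n
      π₂-ι n = x∙y⁻¹≈ε⇒x≈y (π₂ (ι n)) (ι n) (begin
        π₂ (ι n) + - ι n          ≡⟨ cong (π₂ (ι n) +_) (λ₂-neg-ι n) ⟨
        π₂ (ι n) + λ₂ (- ι n)     ≡⟨ π₂+λ₂∘-≡0 (ι n) ⟩
        0#                        ∎)

lemma4p8 : (p k q : ℕ) → Prime p → ¬ (p ≡ 2) → k ≥ 1 → q ≡ p ^ k → q % 3 ≡ 1 →
    (𝔽 : FiniteField q) → let open FiniteField 𝔽 in
    (A : Automorphism) →
    (λ₁ : F → F → F → F) (λ₂ λ₃ : F → F) (π₁ : F → F → F → F) (π₂ π₃ : F → F) →
    (∀ x y z → Inverse.to (Automorphism.φ A) (inj₂ (x , y , z))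
                 ≡ inj₂ (λ₁ x y z , λ₂ y , λ₃ z)) →
    (∀ x y z → Inverse.to (Automorphism.φ A) (inj₁ (x , y , z))
                 ≡ inj₁ (π₁ x y z , π₂ y , π₃ z)) →
    ∀ (n : ℕ) → (λ₂ (ι n) ≡ ι n) × (π₂ (ι n) ≡ ι n)
lemma4p8 p k q p-prime p≢2 k≥1 q≡p^k _ 𝔽 A λ₁ λ₂ λ₃ π₁ π₂ π₃ on-lines on-points n =
  let e , e≢0 , e≢1 = ∃-avoiding-two 3≤q card 0# 1#
  in  λ₂-ι e e≢0 e≢1 n , π₂-ι e e≢0 e≢1 n
  where
  open FiniteField 𝔽
  open CoordinateAutomorphism 𝔽 A λ₁ λ₂ λ₃ π₁ π₂ π₃ on-lines on-points
  3≤q : 3 ≤ q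
  3≤q = subst (3 ≤_) (sym q≡p^k) (3≤oddPrime^k p-prime p≢2 k≥1)
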